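{- For every value $V$, every finite family of intersection types $(\mathcal{M}_i)_{i\in I}$ and every $w\in\mathbb{Q}$, the following are equivalent: (1) $\vdash^{w} V:\biguplus_{i\in I}\mathcal{M}_i$ is derivable (with empty context); (2) there are weights $w_i$ ($i\in I$) such that $\vdash^{w_i}V:\mathcal{M}_i$ is derivable for every $i\in I$ and $w=\sum_{i\in I}w_i$.
   Context: Terms: values $V ::= x \mid \lambda x.M$; terms $M ::= V \mid VV \mid M\oplus M \mid \mathtt{let}\ x = M\ \mathtt{in}\ M$. Types: arrow types $\mathtt{A} ::= \mathcal{M}\to \mathtt{a}$; intersection types $\mathcal{M} ::= [q_1\cdot \mathtt{A}_1,\dots,q_n\cdot\mathtt{A}_n]$ ($n\ge 0$), a finite multiset of pairs with scale factors $q_i\in(0,1]\cap\mathbb{Q}$; type distributions $\mathtt{a} ::= \langle p_1\mathcal{M}_1,\dots,p_n\mathcal{M}_n\rangle$ ($n\ge0$, $p_i\in(0,1]$, $\sum_i p_i\le 1$). $\mathbf{0}$ is the empty type distribution. For a scalar $u$, $u\cdot[q_i\cdot\mathtt{A}_i]_i=[(uq_i)\cdot \mathtt{A}_i]_i$ and $u\cdot\langle p_i\mathcal{M}_i\rangle_i=\langle (up_i)\mathcal{M}_i\rangle_i$; $\uplus$, $\sqcup$ are multiset unions. Typing contexts map variables to intersection types (finitely many nonempty), with pointwise $\uplus$ and scaling $q\cdot\Gamma$. Judgements $\Gamma\vdash^{w} M:\tau$ ($w\in\mathbb{Q}$) are derived by: (Var) $x:\mathcal{M}\vdash^0 x:\mathcal{M}$.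 (Zero) $\vdash^0 M:\mathbf{0}$. (@) from $\Gamma\vdash^{w}V:[1\cdot(\mathcal{M}\to\mathtt{b})]$ and $\Delta\vdash^{v}W:\mathcal{M}$ infer $\Gamma\uplus\Delta\vdash^{w+v}VW:\mathtt{b}$. ($\oplus$) from $\Gamma\vdash^{w}M:\mathtt{a}$, $\Delta\vdash^{v}N:\mathtt{b}$ infer $\tfrac12\cdot\Gamma\uplus\tfrac12\cdot\Delta\vdash^{\frac12 w+\frac12 v+1}M\oplus N:\tfrac12\mathtt{a}\sqcup\tfrac12\mathtt{b}$. ($\lambda$) from $\Gamma,x:\mathcal{M}\vdash^{w}M:\mathtt{b}$ infer $\Gamma\vdash^{w+1}\lambda x.M:\mathcal{M}\to\mathtt{b}$. (let) from $\Gamma\vdash^{v}N:\langle p_k\mathcal{M}_k\rangle_{k\in K}$ and $\Delta_k,x:\mathcal{M}_k\vdash^{w_k}M:\mathtt{b}_k$ ($k\in K$) infer $\Gamma\uplus_{k}p_k\cdot\Delta_k\vdash^{\sum_k p_kw_k+v+1}\mathtt{let}\ x=N\ \mathtt{in}\ M:\bigsqcup_k p_k\mathtt{b}_k$. (Val) from $\Gamma\vdash^{w}V:\mathcal{M}$ infer $\Gamma\vdash^{w}V:\langle 1\mathcal{M}\rangle$. (!) for finite possibly empty $I$, from $\Gamma_i\vdash^{w_i}V:\mathtt{A}_i$ and scale factors $q_i$ infer $\uplus_i q_i\cdot\Gamma_i\vdash^{\sum_i q_iw_i}V:[q_i\cdot\mathtt{A}_i]_{i\in I}$. -}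

module Defs where

open import Data.Nat using (ℕ; zero; suc)
open import Data.Nat.Properties using (_≟_)
open import Data.Fin using (Fin; zero; suc)
open import Data.Rational using (ℚ; 0ℚ; 1ℚ; ½; _+_; _*_; _<_; _≤_)
open import Data.List using (List; []; _∷_; _++_; map)
open import Data.Product using (_×_; _,_)
open import Data.Unit using (⊤)
open import Data.List.Relation.Binary.Permutation.Homogeneous using (Permutation)
open import Relation.Nullary using (yes; no)
open import Relation.Binary.PropositionalEquality using (_≡_)

-- Terms (named variables; x is bound in λx.M and in the body of let)

Var : Set
Var = ℕ

mutual
  data Val : Set where
    var : Var → Val
    lam : Var → Term → Val

  data Term : Set where
    val   : Val → Term
    app   : Val → Val → Term
    _⊕_   : Term → Term → Term
    letin : Var → Term → Term → Term   -- letin x N M  =  let x = N in M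

-- Types.  Multisets are represented by lists; they are identified up to
-- the multiset equivalences _≈A_, _≈I_, _≈D_ below.

data Arr : Set where
  -- M ⇒ a  with M = [q₁·A₁,…] and a = ⟨p₁M₁,…⟩
  _⇒_ : List (ℚ × Arr) → List (ℚ × List (ℚ × Arr)) → Arr

IT : Set
IT = List (ℚ × Arr)

TD : Set
TD = List (ℚ × IT)

𝟎 : TD
𝟎 = []

scaleI : ℚ → IT → IT
scaleI u = map (λ { (q , A) → (u * q , A) })

scaleD : ℚ → TD → TD
scaleD u = map (λ { (p , M) → (u * p , M) })

mutual
  data _≈A_ : Arr → Arr → Set where
    ⇒-cong : ∀ {M M′ a a′} → M ≈I M′ → a ≈D a′ → (M ⇒ a) ≈A (M′ ⇒ a′)

  data _≈qA_ : ℚ × Arr → ℚ × Arr → Set where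
    pairA : ∀ {q A A′} → A ≈A A′ → (q , A) ≈qA (q , A′)

  data _≈I_ : IT → IT → Set where
    permI : ∀ {M M′} → Permutation _≈qA_ M M′ → M ≈I M′

  data _≈pM_ : ℚ × IT → ℚ × IT → Set where
    pairM : ∀ {p M M′} → M ≈I M′ → (p , M) ≈pM (p , M′)

  data _≈D_ : TD → TD → Set where
    permD : ∀ {a a′} → Permutation _≈pM_ a a′ → a ≈D a′

InUnit : ℚ → Set
InUnit q = (0ℚ < q) × (q ≤ 1ℚ)

mutual
  WF-A : Arr → Set
  WF-A (M ⇒ a) = WF-I M × WF-D a

  WF-I : IT → Set
  WF-I [] = ⊤
  WF-I ((q , A) ∷ M) = InUnit q × WF-A A × WF-I M

  WF-Dentries : TD → Set
  WF-Dentries [] = ⊤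
  WF-Dentries ((p , M) ∷ a) = InUnit p × WF-I M × WF-Dentries a

  WF-D : TD → Set
  WF-D a = WF-Dentries a × (mass a ≤ 1ℚ)

  mass : TD → ℚ
  mass [] = 0ℚ
  mass ((p , _) ∷ a) = p + mass a

-- Typing contexts (functions into intersection types; [] = not in domain)

Ctx : Set
Ctx = Var → IT

∅ : Ctx
∅ _ = []

_⊎C_ : Ctx → Ctx → Ctx
(Γ ⊎C Δ) x = Γ x ++ Δ x

scaleC : ℚ → Ctx → Ctx
scaleC q Γ x = scaleI q (Γ x)

_≈C_ : Ctx → Ctx → Set
Γ ≈C Δ = ∀ x → Γ x ≈I Δ x

single : Var → IT → Ctx
single x M y with y ≟ x
... | yes _ = M
... | no  _ = []

-- Γ , x : M   (used with the side condition Γ x ≡ [])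
extend : Ctx → Var → IT → Ctx
extend Γ x M y with y ≟ x
... | yes _ = M
... | no  _ = Γ y

-- Typing judgements  Γ ⊢^w V : A,  Γ ⊢^w V : M,  Γ ⊢^w M : a.
-- Conclusions are taken up to multiset equivalence of contexts/types.

mutual
  data ValA : Ctx → ℚ → Val → Arr → Set where
    tlam : ∀ {Γ Γ′ x M w N b A′}
         → Γ x ≡ []
         → TermD (extend Γ x M) w N b
         → Γ′ ≈C Γ → A′ ≈A (M ⇒ b)
         → ValA Γ′ (w + 1ℚ) (lam x N) A′

  data ValI : Ctx → ℚ → Val → IT → Set where
    tvar  : ∀ {Γ x M M′}
          → WF-I M
          → Γ ≈C single x M → M′ ≈I M
          → ValI Γ 0ℚ (var x) M′
    tbang : ∀ {Γ Γ′ w V M M′}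
          → Bang Γ w V M
          → Γ′ ≈C Γ → M′ ≈I M
          → ValI Γ′ w V M′

  -- premises of rule (!) over a finite (list-indexed) family I:
  -- Bang (⊎ᵢ qᵢ·Γᵢ) (Σᵢ qᵢwᵢ) V [qᵢ·Aᵢ]ᵢ
  data Bang : Ctx → ℚ → Val → IT → Set where
    bnil  : ∀ {V} → Bang ∅ 0ℚ V []
    bcons : ∀ {Γ Δ q w v V A M}
          → InUnit q
          → ValA Γ w V A
          → Bang Δ v V M
          → Bang (scaleC q Γ ⊎C Δ) (q * w + v) V ((q , A) ∷ M)

  data TermD : Ctx → ℚ → Term → TD → Set where
    tzero : ∀ {Γ N a}
          → Γ ≈C ∅ → a ≈D 𝟎
          → TermD Γ 0ℚ N a
    tval  : ∀ {Γ Γ′ w V M a}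
          → ValI Γ w V M
          → Γ′ ≈C Γ → a ≈D ((1ℚ , M) ∷ [])
          → TermD Γ′ w (val V) a
    tapp  : ∀ {Γ Δ Θ w v V W M b c}
          → ValI Γ w V ((1ℚ , (M ⇒ b)) ∷ [])
          → ValI Δ v W M
          → Θ ≈C (Γ ⊎C Δ) → c ≈D b
          → TermD Θ (w + v) (app V W) c
    toplus : ∀ {Γ Δ Θ w v M N a b c}
          → TermD Γ w M a
          → TermD Δ v N b
          → Θ ≈C (scaleC ½ Γ ⊎C scaleC ½ Δ)
          → c ≈D (scaleD ½ a ++ scaleD ½ b)
          → TermD Θ (½ * w + ½ * v + 1ℚ) (M ⊕ N) c
    tlet  : ∀ {Γ Δ Θ v w x N M ds b c}
          → TermD Γ v N ds
          → Branches x M ds Δ w b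
          → Θ ≈C (Γ ⊎C Δ) → c ≈D b
          → TermD Θ (w + v + 1ℚ) (letin x N M) c

  -- premises of rule (let) for N : ⟨pₖMₖ⟩ₖ :
  -- Branches x M ⟨pₖMₖ⟩ₖ (⊎ₖ pₖ·Δₖ) (Σₖ pₖwₖ) (⊔ₖ pₖ·bₖ)
  data Branches (x : Var) (M : Term) : TD → Ctx → ℚ → TD → Set where
    brnil  : Branches x M [] ∅ 0ℚ []
    brcons : ∀ {p Mk Δk wk bk ds Δ w b}
           → Δk x ≡ []
           → TermD (extend Δk x Mk) wk M bk
           → Branches x M ds Δ w b
           → Branches x M ((p , Mk) ∷ ds) (scaleC p Δk ⊎C Δ) (p * wk + w) (scaleD p bk ++ b)

⨄ : ∀ {n} → (Fin n → IT) → IT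
⨄ {zero}  _ = []
⨄ {suc n} f = f zero ++ ⨄ (λ i → f (suc i))

Σℚ : ∀ {n} → (Fin n → ℚ) → ℚ
Σℚ {zero}  _ = 0ℚ
Σℚ {suc n} f = f zero + Σℚ (λ i → f (suc i))

-- In the empty context, a derivation of V : M ends with rule (!) (or with (Var), which
-- then forces M = []), and the premises of (!) are again closed.  Closed typings of V
-- at a multiset M are therefore the same thing as families of closed arrow typings of
-- V, one for each element q·A of M, with weight the q-scaled sum of their weights.
-- Such families are stable under permutation (weights are added commutatively) and
-- split and concatenate along ++, which is ⊎ on multisets.
module Submission where

open import Defs
open import Data.Nat using (ℕ; zero; suc)
open import Data.Nat.Properties using (_≟_)
open import Data.Fin using (Fin; zero; suc)
open import Data.Fin.Properties using (∀-cons)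
open import Data.Vec.Functional as Vector using ()
open import Data.Rational using (ℚ; 0ℚ; _+_; _*_)
open import Data.Rational.Properties using (+-assoc; +-identityˡ; +-0-commutativeMonoid)
open import Algebra.Bundles using (CommutativeMonoid)
open import Algebra.Properties.CommutativeSemigroup
  (CommutativeMonoid.commutativeSemigroup +-0-commutativeMonoid) using (x∙yz≈y∙xz)
open import Data.List using ([]; _∷_; _++_)
open import Data.List.Properties using (++-conicalˡ; ++-conicalʳ)
open import Data.List.Relation.Binary.Permutation.Homogeneous as Perm using (Permutation)
open import Data.List.Relation.Binary.Pointwise.Base using (Pointwise; []; _∷_)
open import Data.Product using (Σ; _×_; _,_)
open import Data.Empty using (⊥-elim)
open import Function.Bundles using (_⇔_; mk⇔; Equivalence)
open import Relation.Nullary using (yes; no)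
open import Relation.Binary.PropositionalEquality using (_≡_; refl; sym; trans; subst)

Permutation-[]ˡ : ∀ {A : Set} {R : A → A → Set} {xs} → Permutation R [] xs → xs ≡ []
Permutation-[]ˡ (Perm.refl []) = refl
Permutation-[]ˡ (Perm.trans p q) with Permutation-[]ˡ p
... | refl = Permutation-[]ˡ q

Permutation-[]ʳ : ∀ {A : Set} {R : A → A → Set} {xs} → Permutation R xs [] → xs ≡ []
Permutation-[]ʳ (Perm.refl []) = refl
Permutation-[]ʳ (Perm.trans p q) with Permutation-[]ʳ q
... | refl = Permutation-[]ʳ p

mutual
  ≈A-refl : (A : Arr) → A ≈A A
  ≈A-refl (M ⇒ a) = ⇒-cong (≈I-refl M) (≈D-refl a)

  ≈I-refl : (M : IT) → M ≈I M
  ≈I-refl M = permI (Perm.refl (≈qA-pointwise-refl M))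

  ≈qA-pointwise-refl : (M : IT) → Pointwise _≈qA_ M M
  ≈qA-pointwise-refl [] = []
  ≈qA-pointwise-refl ((q , A) ∷ M) = pairA (≈A-refl A) ∷ ≈qA-pointwise-refl M

  ≈D-refl : (a : TD) → a ≈D a
  ≈D-refl a = permD (Perm.refl (≈pM-pointwise-refl a))

  ≈pM-pointwise-refl : (a : TD) → Pointwise _≈pM_ a a
  ≈pM-pointwise-refl [] = []
  ≈pM-pointwise-refl ((p , M) ∷ a) = pairM (≈I-refl M) ∷ ≈pM-pointwise-refl a

≈A-trans : ∀ {A B C} → A ≈A B → B ≈A C → A ≈A C
≈A-trans (⇒-cong (permI i) (permD d)) (⇒-cong (permI i′) (permD d′)) =
  ⇒-cong (permI (Perm.trans i i′)) (permD (Perm.trans d d′))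

ValA-resp-≈A : ∀ {Γ w V A A′} → A′ ≈A A → ValA Γ w V A → ValA Γ w V A′
ValA-resp-≈A A′≈A (tlam fresh body Γ′≈Γ A≈M⇒b) = tlam fresh body Γ′≈Γ (≈A-trans A′≈A A≈M⇒b)

Closed : Ctx → Set
Closed Γ = ∀ x → Γ x ≡ []

∅-closed : Closed ∅
∅-closed _ = refl

≈C-∅-closed : ∀ {Γ} → ∅ ≈C Γ → Closed Γ
≈C-∅-closed ∅≈Γ x with ∅≈Γ x
... | permI p = Permutation-[]ˡ p

scaleI-≡-[] : ∀ q (M : IT) → scaleI q M ≡ [] → M ≡ []
scaleI-≡-[] q [] _ = refl

Closed-scaleC-⊎Cˡ : ∀ q Γ Δ → Closed (scaleC q Γ ⊎C Δ) → Closed Γ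
Closed-scaleC-⊎Cˡ q Γ Δ closed x = scaleI-≡-[] q (Γ x) (++-conicalˡ _ (Δ x) (closed x))

Closed-scaleC-⊎Cʳ : ∀ q Γ Δ → Closed (scaleC q Γ ⊎C Δ) → Closed Δ
Closed-scaleC-⊎Cʳ q Γ Δ closed x = ++-conicalʳ (scaleI q (Γ x)) _ (closed x)

Closed-scaleC-⊎C : ∀ q Γ Δ → Closed Γ → Closed Δ → Closed (scaleC q Γ ⊎C Δ)
Closed-scaleC-⊎C q Γ Δ closedΓ closedΔ x rewrite closedΓ x | closedΔ x = refl

single-self : ∀ x M → single x M x ≡ M
single-self x M with x ≟ x
... | yes _ = refl
... | no x≢x = ⊥-elim (x≢x refl)

data ClosedBang (V : Val) : ℚ → IT → Set where
  []   : ClosedBang V 0ℚ []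
  cons : ∀ {Γ q w v A M} → InUnit q → ValA Γ w V A → Closed Γ → ClosedBang V v M
       → ClosedBang V (q * w + v) ((q , A) ∷ M)

Bang⇒ClosedBang : ∀ {Γ w V M} → Bang Γ w V M → Closed Γ → ClosedBang V w M
Bang⇒ClosedBang bnil _ = []
Bang⇒ClosedBang (bcons {Γ = Γ} {Δ = Δ} {q = q} q∈I d b) closed =
  cons q∈I d (Closed-scaleC-⊎Cˡ q Γ Δ closed) (Bang⇒ClosedBang b (Closed-scaleC-⊎Cʳ q Γ Δ closed))

ClosedBang⇒Bang : ∀ {w V M} → ClosedBang V w M → Σ Ctx (λ Γ → Bang Γ w V M × Closed Γ)
ClosedBang⇒Bang [] = ∅ , bnil , ∅-closed
ClosedBang⇒Bang (cons {Γ = Γ} {q = q} q∈I d closedΓ b) with ClosedBang⇒Bang b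
... | Δ , bang , closedΔ = scaleC q Γ ⊎C Δ , bcons q∈I d bang , Closed-scaleC-⊎C q Γ Δ closedΓ closedΔ

mutual
  ClosedBang-resp-↭ : ∀ {V w M M′} → Permutation _≈qA_ M′ M → ClosedBang V w M → ClosedBang V w M′
  ClosedBang-resp-↭ (Perm.refl pw) b = ClosedBang-resp-pointwise pw b
  ClosedBang-resp-↭ (Perm.prep (pairA A≈) p) (cons q∈I d closed b) =
    cons q∈I (ValA-resp-≈A A≈ d) closed (ClosedBang-resp-↭ p b)
  ClosedBang-resp-↭ (Perm.swap (pairA A≈) (pairA B≈) p)
    (cons {q = q} {w = w} q∈I d closed (cons {q = q′} {w = w′} {v = v} q′∈I d′ closed′ b)) =
    subst (λ u → ClosedBang _ u _) (x∙yz≈y∙xz (q′ * w′) (q * w) v)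
      (cons q′∈I (ValA-resp-≈A A≈ d′) closed′
        (cons q∈I (ValA-resp-≈A B≈ d) closed (ClosedBang-resp-↭ p b)))
  ClosedBang-resp-↭ (Perm.trans p q) b = ClosedBang-resp-↭ p (ClosedBang-resp-↭ q b)

  ClosedBang-resp-pointwise : ∀ {V w M M′} → Pointwise _≈qA_ M′ M → ClosedBang V w M → ClosedBang V w M′
  ClosedBang-resp-pointwise [] [] = []
  ClosedBang-resp-pointwise (pairA A≈ ∷ pw) (cons q∈I d closed b) =
    cons q∈I (ValA-resp-≈A A≈ d) closed (ClosedBang-resp-pointwise pw b)

ValI-∅⇔ClosedBang : ∀ {w V M} → ValI ∅ w V M ⇔ ClosedBang V w M
ValI-∅⇔ClosedBang {M = M} = mk⇔ to from
  where
  to : ∀ {w V M} → ValI ∅ w V M → ClosedBang V w M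
  to (tvar {x = x} {M = M₀} _ ∅≈single (permI M′↭M₀))
    with trans (sym (single-self x M₀)) (≈C-∅-closed ∅≈single x)
  ... | refl with Permutation-[]ʳ M′↭M₀
  ... | refl = []
  to (tbang bang ∅≈Γ (permI M′↭M)) = ClosedBang-resp-↭ M′↭M (Bang⇒ClosedBang bang (≈C-∅-closed ∅≈Γ))

  from : ∀ {w V} → ClosedBang V w M → ValI ∅ w V M
  from b with ClosedBang⇒Bang b
  ... | Γ , bang , closed =
    tbang bang (λ x → subst (∅ x ≈I_) (sym (closed x)) (≈I-refl [])) (≈I-refl M)

ClosedBang-[]-weight : ∀ {V w} → ClosedBang V w [] → w ≡ 0ℚ
ClosedBang-[]-weight [] = refl

ClosedBang-++⁺ : ∀ {V w₁ w₂ M N} → ClosedBang V w₁ M → ClosedBang V w₂ N → ClosedBang V (w₁ + w₂) (M ++ N)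
ClosedBang-++⁺ {w₂ = w₂} [] c = subst (λ u → ClosedBang _ u _) (sym (+-identityˡ w₂)) c
ClosedBang-++⁺ {w₂ = w₂} (cons {q = q} {w = w} {v = v} q∈I d closed b) c =
  subst (λ u → ClosedBang _ u _) (sym (+-assoc (q * w) v w₂)) (cons q∈I d closed (ClosedBang-++⁺ b c))

ClosedBang-++⁻ : ∀ {V w} (M N : IT) → ClosedBang V w (M ++ N)
               → Σ ℚ (λ w₁ → Σ ℚ (λ w₂ → ClosedBang V w₁ M × ClosedBang V w₂ N × w ≡ w₁ + w₂))
ClosedBang-++⁻ [] N b = 0ℚ , _ , [] , b , sym (+-identityˡ _)
ClosedBang-++⁻ (_ ∷ M) N (cons {q = q} {w = w} q∈I d closed b) with ClosedBang-++⁻ M N b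
... | w₁ , w₂ , b₁ , b₂ , refl = _ , w₂ , cons q∈I d closed b₁ , b₂ , sym (+-assoc (q * w) w₁ w₂)

ClosedBang-⨄⁺ : ∀ {V} n (Ms : Fin n → IT) (ws : Fin n → ℚ)
              → (∀ i → ClosedBang V (ws i) (Ms i)) → ClosedBang V (Σℚ ws) (⨄ Ms)
ClosedBang-⨄⁺ zero Ms ws bs = []
ClosedBang-⨄⁺ (suc n) Ms ws bs =
  ClosedBang-++⁺ (bs zero) (ClosedBang-⨄⁺ n (λ i → Ms (suc i)) (λ i → ws (suc i)) (λ i → bs (suc i)))

ClosedBang-⨄⁻ : ∀ {V w} n (Ms : Fin n → IT) → ClosedBang V w (⨄ Ms)
              → Σ (Fin n → ℚ) (λ ws → (∀ i → ClosedBang V (ws i) (Ms i)) × (w ≡ Σℚ ws))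
ClosedBang-⨄⁻ zero Ms b = (λ ()) , (λ ()) , ClosedBang-[]-weight b
ClosedBang-⨄⁻ {V} (suc n) Ms b with ClosedBang-++⁻ (Ms zero) _ b
... | w₁ , w₂ , b₁ , b₂ , refl with ClosedBang-⨄⁻ n (λ i → Ms (suc i)) b₂
... | ws , bs , refl =
  w₁ Vector.∷ ws , ∀-cons {P = λ i → ClosedBang V ((w₁ Vector.∷ ws) i) (Ms i)} b₁ bs , refl

mainTheorem2 : (V : Val) (n : ℕ) (Ms : Fin n → IT) (w : ℚ)
    → (∀ i → WF-I (Ms i))
    → ValI ∅ w V (⨄ Ms)
      ⇔ Σ (Fin n → ℚ) (λ ws → (∀ i → ValI ∅ (ws i) V (Ms i)) × (w ≡ Σℚ ws))
mainTheorem2 V n Ms w _ = mk⇔ split join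
  where
  open Equivalence
  split : ValI ∅ w V (⨄ Ms) → Σ (Fin n → ℚ) (λ ws → (∀ i → ValI ∅ (ws i) V (Ms i)) × (w ≡ Σℚ ws))
  split d with ClosedBang-⨄⁻ n Ms (to ValI-∅⇔ClosedBang d)
  ... | ws , bs , w≡Σws = ws , (λ i → from ValI-∅⇔ClosedBang (bs i)) , w≡Σws

  join : Σ (Fin n → ℚ) (λ ws → (∀ i → ValI ∅ (ws i) V (Ms i)) × (w ≡ Σℚ ws)) → ValI ∅ w V (⨄ Ms)
  join (ws , ds , refl) =
    from ValI-∅⇔ClosedBang (ClosedBang-⨄⁺ n Ms ws (λ i → to ValI-∅⇔ClosedBang (ds i)))
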